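{- Let $C\subseteq\{0,1\}^n$ be such that $|C|\ge 2^{\alpha n}$ and every two distinct $x,y\in C$ are at Hamming distance at least $\beta n$, where $\alpha,\beta\in(0,1)$ are constants. If $f\colon\{0,1\}^m\to\{0,1\}^n$ is a $d$-local function with $f(\{0,1\}^m)=C$, then $d\ge\alpha\beta n$.
   Context: An input bit $i\in[m]$ affects an output bit $j\in[n]$ of $f$ if there exist $x,x'\in\{0,1\}^m$ differing only in coordinate $i$ with $f(x)_j\ne f(x')_j$. $f$ is $d$-local if each output bit is affected by at most $d$ input bits.
   Formalization: The constants α and β range over the rationals in (0,1). -}

module Defs where

open import Data.Bool using (Bool; true; false)
open import Data.Nat using (ℕ; zero; suc; _+_; _*_; _^_; _≤_)
open import Data.Integer using (+_)
import Data.Integer as ℤ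
open import Data.Fin using (Fin)
open import Data.Fin.Subset using (Subset; _∈_; ∣_∣)
open import Data.Vec using (Vec; []; _∷_; lookup)
open import Data.List using (List; length)
import Data.List.Membership.Propositional as LM
open import Data.Product using (Σ; _×_; ∃; ∃-syntax)
open import Relation.Binary.PropositionalEquality using (_≡_; _≢_)
open import Data.Rational using (ℚ; _/_; ↥_; ↧ₙ_)

BitStr : ℕ → Set
BitStr n = Vec Bool n

hamming : ∀ {n} → BitStr n → BitStr n → ℕ
hamming []       []       = 0
hamming (true  ∷ xs) (true  ∷ ys) = hamming xs ys
hamming (false ∷ xs) (false ∷ ys) = hamming xs ys
hamming (true  ∷ xs) (false ∷ ys) = suc (hamming xs ys)
hamming (false ∷ xs) (true  ∷ ys) = suc (hamming xs ys)

DifferOnlyAt : ∀ {m} → Fin m → BitStr m → BitStr m → Set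
DifferOnlyAt i x x' =
  (∀ k → k ≢ i → lookup x k ≡ lookup x' k) × (lookup x i ≢ lookup x' i)

Affects : ∀ {m n} → (BitStr m → BitStr n) → Fin m → Fin n → Set
Affects f i j =
  ∃[ x ] ∃[ x' ] (DifferOnlyAt i x x' × lookup (f x) j ≢ lookup (f x') j)

Local : ∀ {m n} → ℕ → (BitStr m → BitStr n) → Set
Local {m} d f =
  ∀ j → ∃[ S ] ((∣ S ∣ ≤ d) × (∀ i → Affects f i j → i ∈ S))

ImageIs : ∀ {m n} → (BitStr m → BitStr n) → List (BitStr n) → Set
ImageIs f C = (∀ x → f x LM.∈ C) × (∀ y → y LM.∈ C → ∃[ x ] (f x ≡ y))

ℕ→ℚ : ℕ → ℚ
ℕ→ℚ k = + k / 1

-- 2^(α·n) ≤ c for a rational α ≥ 0, written α = p/q: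
-- equivalent to 2^(p·n) ≤ c^q.
TwoPowLe : ℚ → ℕ → ℕ → Set
TwoPowLe α n c = 2 ^ (ℤ.∣ ↥ α ∣ * n) ≤ c ^ (↧ₙ α)

{-# OPTIONS --safe #-}
-- Call an input bit heavy if it affects at least βn output bits. A light input
-- affects no output at all: flipping it moves f x to a codeword at distance at
-- most its number of affected outputs, which is below βn. So f factors through
-- its h heavy inputs and |C| ≤ 2^h, while counting the pairs (input, output it
-- affects) gives h·βn ≤ nd. Hence αn ≤ log₂|C| ≤ h ≤ d/β.
module Submission where

open import Defs

module Combinatorics where

  open import Data.Bool using (Bool; true; false)
  open import Data.Bool.Properties using (T-≡) renaming (_≟_ to _≟ᵇ_)
  open import Data.Fin using (Fin; zero; suc)
  open import Data.Fin.Subset using (Subset; _∉_; ∣_∣) renaming (_∈_ to _∈ˢ_)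
  open import Data.Fin.Subset.Properties using (drop-there)
  open import Data.List using (List; length; map; _++_) renaming ([] to []ₗ; _∷_ to _∷ₗ_)
  open import Data.List.Properties using (length-++; length-map)
  open import Data.List.Membership.Propositional using (_∈_)
  open import Data.List.Membership.Propositional.Properties using (∈-map⁺; ∈-++⁺ˡ; ∈-++⁺ʳ; ∈-++⁻; ∈-∃++)
  open import Data.List.Relation.Binary.Subset.Propositional using (_⊆_)
  open import Data.List.Relation.Unary.All using () renaming (lookup to lookupᴬ)
  open import Data.List.Relation.Unary.AllPairs using (_∷_)
  open import Data.List.Relation.Unary.Any using (here; there)
  open import Data.List.Relation.Unary.Unique.Propositional using (Unique)
  open import Data.Nat using (ℕ; zero; suc; _+_; _*_; _^_; _≤_; _≤ᵇ_; z≤n; s≤s)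
  open import Data.Nat.Properties
  open import Data.Nat.Tactic.RingSolver using (solve-∀)
  open import Algebra.Properties.Semiring.Sum +-*-semiring
    using (sum; sum-syntax; ∑-comm; sum-cong-≗; *-distribʳ-sum)
  open import Data.Product using (_×_; _,_; proj₁; proj₂; ∃-syntax)
  open import Data.Sum using (inj₁; inj₂)
  open import Data.Vec using (Vec; []; _∷_; lookup; tabulate; _[_]≔_)
  open import Data.Vec.Properties using
    (lookup∘tabulate; tabulate∘lookup; tabulate-cong; []≔-lookup; lookup∘update; lookup∘update′; []=⇒lookup; lookup⇒[]=)
  open import Function using (_∘_; Equivalence)
  open import Relation.Nullary using (¬_; yes; no; contradiction)
  open import Relation.Binary.PropositionalEquality
    using (_≡_; _≢_; refl; sym; trans; cong; cong₂; subst; module ≡-Reasoning)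

  indicator : Bool → ℕ
  indicator true  = 1
  indicator false = 0

  ∣p∣≡∑indicator : ∀ {k} (p : Subset k) → ∣ p ∣ ≡ ∑[ i < k ] indicator (lookup p i)
  ∣p∣≡∑indicator []          = refl
  ∣p∣≡∑indicator (true  ∷ p) = cong suc (∣p∣≡∑indicator p)
  ∣p∣≡∑indicator (false ∷ p) = ∣p∣≡∑indicator p

  ∈⇒1≤indicator : ∀ {k} {i : Fin k} {p : Subset k} → i ∈ˢ p → 1 ≤ indicator (lookup p i)
  ∈⇒1≤indicator i∈p rewrite []=⇒lookup i∈p = ≤-refl

  ∑-bounded : ∀ {k} c (t : Fin k → ℕ) → (∀ i → t i ≤ c) → sum t ≤ k * c
  ∑-bounded {zero}  c t t≤c = z≤n
  ∑-bounded {suc k} c t t≤c = +-mono-≤ (t≤c zero) (∑-bounded c (t ∘ suc) (t≤c ∘ suc))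

  atLeast : ∀ {k} → ℕ → (Fin k → ℕ) → Subset k
  atLeast c t = tabulate (λ i → c ≤ᵇ t i)

  ≤⇒∈atLeast : ∀ {k c} {t : Fin k → ℕ} {i} → c ≤ t i → i ∈ˢ atLeast c t
  ≤⇒∈atLeast {i = i} c≤tᵢ =
    lookup⇒[]= i _ (trans (lookup∘tabulate _ i) (Equivalence.to T-≡ (≤⇒≤ᵇ c≤tᵢ)))

  markov : ∀ {k} c (t : Fin k → ℕ) → ∣ atLeast c t ∣ * c ≤ sum t
  markov {zero}  c t = z≤n
  markov {suc k} c t with c ≤ᵇ t zero in c≤ᵇt₀
  ... | true  = +-mono-≤ (≤ᵇ⇒≤ c (t zero) (Equivalence.from T-≡ c≤ᵇt₀)) (markov c (t ∘ suc))
  ... | false = ≤-trans (markov c (t ∘ suc)) (m≤n+m _ _)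

  hamming≤∑ : ∀ {k} (u v : BitStr k) (g : Fin k → ℕ) →
    (∀ j → lookup u j ≢ lookup v j → 1 ≤ g j) → hamming u v ≤ sum g
  hamming≤∑ []          []          g h = z≤n
  hamming≤∑ (true  ∷ u) (true  ∷ v) g h = ≤-trans (hamming≤∑ u v (g ∘ suc) (h ∘ suc)) (m≤n+m _ _)
  hamming≤∑ (false ∷ u) (false ∷ v) g h = ≤-trans (hamming≤∑ u v (g ∘ suc) (h ∘ suc)) (m≤n+m _ _)
  hamming≤∑ (true  ∷ u) (false ∷ v) g h = +-mono-≤ (h zero λ ()) (hamming≤∑ u v (g ∘ suc) (h ∘ suc))
  hamming≤∑ (false ∷ u) (true  ∷ v) g h = +-mono-≤ (h zero λ ()) (hamming≤∑ u v (g ∘ suc) (h ∘ suc))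

  Unique-⊆⇒length≤ : ∀ {A : Set} {xs ys : List A} → Unique xs → xs ⊆ ys → length xs ≤ length ys
  Unique-⊆⇒length≤ {xs = []ₗ} _ _ = z≤n
  Unique-⊆⇒length≤ {xs = x ∷ₗ xs} (x≢xs ∷ unique) xs⊆ys
    with as , bs , refl ← ∈-∃++ (xs⊆ys (here refl)) = begin
      suc (length xs)               ≤⟨ s≤s (Unique-⊆⇒length≤ unique xs⊆as++bs) ⟩
      suc (length (as ++ bs))       ≡⟨ cong suc (length-++ as) ⟩
      suc (length as + length bs)   ≡⟨ +-suc (length as) (length bs) ⟨
      length as + length (x ∷ₗ bs)  ≡⟨ length-++ as ⟨
      length (as ++ x ∷ₗ bs)        ∎
    where
    open ≤-Reasoning
    xs⊆as++bs : xs ⊆ as ++ bs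
    xs⊆as++bs y∈xs with ∈-++⁻ as (xs⊆ys (there y∈xs))
    ... | inj₁ y∈as          = ∈-++⁺ˡ y∈as
    ... | inj₂ (here refl)   = contradiction refl (lookupᴬ x≢xs y∈xs)
    ... | inj₂ (there y∈bs)  = ∈-++⁺ʳ as y∈bs

  Ignores : ∀ {k} {A : Set} → (BitStr k → A) → Fin k → Set
  Ignores g i = ∀ x b → g x ≡ g (x [ i ]≔ b)

  restrict : ∀ {k} → Subset k → BitStr k → BitStr k
  restrict []          []      = []
  restrict (true  ∷ R) (a ∷ x) = a ∷ restrict R x
  restrict (false ∷ R) (_ ∷ x) = false ∷ restrict R x

  subcube : ∀ {k} → Subset k → List (BitStr k)
  subcube []          = [] ∷ₗ []ₗ
  subcube (true  ∷ R) = map (true ∷_) (subcube R) ++ map (false ∷_) (subcube R)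
  subcube (false ∷ R) = map (false ∷_) (subcube R)

  length-subcube : ∀ {k} (R : Subset k) → length (subcube R) ≡ 2 ^ ∣ R ∣
  length-subcube [] = refl
  length-subcube (true ∷ R) = begin
    length (map (true ∷_) (subcube R) ++ map (false ∷_) (subcube R))
      ≡⟨ length-++ (map (true ∷_) (subcube R)) ⟩
    length (map (true ∷_) (subcube R)) + length (map (false ∷_) (subcube R))
      ≡⟨ cong₂ _+_ (length-map (true ∷_) (subcube R)) (length-map (false ∷_) (subcube R)) ⟩
    length (subcube R) + length (subcube R)
      ≡⟨ cong₂ _+_ (length-subcube R) (trans (length-subcube R) (sym (+-identityʳ _))) ⟩
    2 ^ ∣ true ∷ R ∣ ∎
    where open ≡-Reasoning
  length-subcube (false ∷ R) = trans (length-map (false ∷_) (subcube R)) (length-subcube R)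

  restrict∈subcube : ∀ {k} (R : Subset k) x → restrict R x ∈ subcube R
  restrict∈subcube []          []          = here refl
  restrict∈subcube (true  ∷ R) (true  ∷ x) = ∈-++⁺ˡ (∈-map⁺ (true ∷_) (restrict∈subcube R x))
  restrict∈subcube (true  ∷ R) (false ∷ x) =
    ∈-++⁺ʳ (map (true ∷_) (subcube R)) (∈-map⁺ (false ∷_) (restrict∈subcube R x))
  restrict∈subcube (false ∷ R) (_     ∷ x) = ∈-map⁺ (false ∷_) (restrict∈subcube R x)

  ≡∘restrict : ∀ {k} {A : Set} (R : Subset k) (g : BitStr k → A) →
    (∀ i → i ∉ R → Ignores g i) → ∀ x → g x ≡ g (restrict R x)
  ≡∘restrict []          g ignores []      = refl
  ≡∘restrict (true  ∷ R) g ignores (a ∷ x) =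
    ≡∘restrict R (g ∘ (a ∷_)) (λ i i∉R y → ignores (suc i) (i∉R ∘ drop-there) (a ∷ y)) x
  ≡∘restrict (false ∷ R) g ignores (a ∷ x) = trans (ignores zero (λ ()) (a ∷ x) false)
    (≡∘restrict R (g ∘ (false ∷_)) (λ i i∉R y → ignores (suc i) (i∉R ∘ drop-there) (false ∷ y)) x)

  junta-image-length≤ : ∀ {k} {A : Set} (R : Subset k) (g : BitStr k → A) (C : List A) → Unique C →
    (∀ y → y ∈ C → ∃[ x ] g x ≡ y) → (∀ i → i ∉ R → Ignores g i) → length C ≤ 2 ^ ∣ R ∣
  junta-image-length≤ R g C unique onto ignores = begin
    length C                   ≤⟨ Unique-⊆⇒length≤ unique C⊆image ⟩
    length (map g (subcube R)) ≡⟨ length-map g (subcube R) ⟩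
    length (subcube R)         ≡⟨ length-subcube R ⟩
    2 ^ ∣ R ∣                  ∎
    where
    open ≤-Reasoning
    C⊆image : C ⊆ map g (subcube R)
    C⊆image {y} y∈C with x , refl ← onto y y∈C =
      subst (_∈ map g (subcube R)) (sym (≡∘restrict R g ignores x)) (∈-map⁺ g (restrict∈subcube R x))

  ≗-lookup⇒≡ : ∀ {k} {A : Set} {u v : Vec A k} → (∀ j → lookup u j ≡ lookup v j) → u ≡ v
  ≗-lookup⇒≡ {u = u} {v} u≗v = begin
    u                   ≡⟨ tabulate∘lookup u ⟨
    tabulate (lookup u) ≡⟨ tabulate-cong u≗v ⟩
    tabulate (lookup v) ≡⟨ tabulate∘lookup v ⟩
    v                   ∎
    where open ≡-Reasoning

  ¬Affects⇒Ignores : ∀ {m n} (f : BitStr m → BitStr n) i → (∀ j → ¬ Affects f i j) → Ignores f i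
  ¬Affects⇒Ignores {m} f i unaffected x b with b ≟ᵇ lookup x i
  ... | yes refl = cong f (sym ([]≔-lookup x i))
  ... | no  b≢xᵢ = ≗-lookup⇒≡ agree
    where
    x′ : BitStr m
    x′ = x [ i ]≔ b
    differ : DifferOnlyAt i x x′
    differ = (λ k k≢i → sym (lookup∘update′ k≢i x b))
           , (λ xᵢ≡x′ᵢ → b≢xᵢ (sym (trans xᵢ≡x′ᵢ (lookup∘update i x b))))
    agree : ∀ j → lookup (f x) j ≡ lookup (f x′) j
    agree j with lookup (f x) j ≟ᵇ lookup (f x′) j
    ... | yes same = same
    ... | no  fxⱼ≢fx′ⱼ = contradiction (x , x′ , differ , fxⱼ≢fx′ⱼ) (unaffected j)

  module _ {m n d : ℕ} (f : BitStr m → BitStr n) (local : Local d f) where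

    support : Fin n → Subset m
    support j = proj₁ (local j)

    degree : Fin m → ℕ
    degree i = ∑[ j < n ] indicator (lookup (support j) i)

    ∑degree≤n*d : sum degree ≤ n * d
    ∑degree≤n*d = begin
      ∑[ i < m ] ∑[ j < n ] indicator (lookup (support j) i)
        ≡⟨ ∑-comm (λ i j → indicator (lookup (support j) i)) ⟩
      ∑[ j < n ] ∑[ i < m ] indicator (lookup (support j) i)
        ≡⟨ sum-cong-≗ (∣p∣≡∑indicator ∘ support) ⟨
      ∑[ j < n ] ∣ support j ∣
        ≤⟨ ∑-bounded d _ (proj₁ ∘ proj₂ ∘ local) ⟩
      n * d ∎
      where open ≤-Reasoning

    hamming≤degree : ∀ {i x x′} → DifferOnlyAt i x x′ → hamming (f x) (f x′) ≤ degree i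
    hamming≤degree {i} {x} {x′} differ = hamming≤∑ (f x) (f x′) _ λ j fxⱼ≢fx′ⱼ →
      ∈⇒1≤indicator (proj₂ (proj₂ (local j)) i (x , x′ , differ , fxⱼ≢fx′ⱼ))

  local-code⇒small-junta : ∀ {m n d r s} {C : List (BitStr n)} {f : BitStr m → BitStr n} →
    Unique C → ImageIs f C → Local d f →
    (∀ x y → x ∈ C → y ∈ C → x ≢ y → r * n ≤ hamming x y * s) →
    ∃[ R ] (length C ≤ 2 ^ ∣ R ∣ × ∣ R ∣ * (r * n) ≤ n * d * s)
  local-code⇒small-junta {m} {n} {d} {r} {s} {C} {f} unique (f∈C , onto) local distance =
    R , junta-image-length≤ R f C unique onto light⇒ignored , ∣R∣*rn≤nds
    where
    weight : Fin m → ℕ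
    weight i = degree f local i * s

    R : Subset m
    R = atLeast (r * n) weight

    affects⇒heavy : ∀ {i j} → Affects f i j → r * n ≤ weight i
    affects⇒heavy {j = j} (x , x′ , differ , fxⱼ≢fx′ⱼ) =
      ≤-trans (distance (f x) (f x′) (f∈C x) (f∈C x′) (fxⱼ≢fx′ⱼ ∘ cong (λ v → lookup v j)))
              (*-monoˡ-≤ s (hamming≤degree f local differ))

    light⇒ignored : ∀ i → i ∉ R → Ignores f i
    light⇒ignored i i∉R = ¬Affects⇒Ignores f i λ j → i∉R ∘ ≤⇒∈atLeast ∘ affects⇒heavy

    ∣R∣*rn≤nds : ∣ R ∣ * (r * n) ≤ n * d * s
    ∣R∣*rn≤nds = begin
      ∣ R ∣ * (r * n)           ≤⟨ markov (r * n) weight ⟩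
      sum weight                ≡⟨ *-distribʳ-sum s (degree f local) ⟨
      sum (degree f local) * s  ≤⟨ *-monoˡ-≤ s (∑degree≤n*d f local) ⟩
      n * d * s                 ∎
      where open ≤-Reasoning

  2^-cancel-≤ : ∀ {a b} → 2 ^ a ≤ 2 ^ b → a ≤ b
  2^-cancel-≤ 2^a≤2^b = ≮⇒≥ λ b<a → <⇒≱ (^-monoʳ-< 2 (s≤s (s≤s z≤n)) b<a) 2^a≤2^b

  rate≤junta-size : ∀ {p q n c k} → 2 ^ (p * n) ≤ c ^ q → c ≤ 2 ^ k → p * n ≤ k * q
  rate≤junta-size {p} {q} {n} {c} {k} 2^pn≤cᵠ c≤2ᵏ = 2^-cancel-≤ (begin
    2 ^ (p * n)  ≤⟨ 2^pn≤cᵠ ⟩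
    c ^ q        ≤⟨ ^-monoˡ-≤ q c≤2ᵏ ⟩
    (2 ^ k) ^ q  ≡⟨ ^-*-assoc 2 k q ⟩
    2 ^ (k * q)  ∎)
    where open ≤-Reasoning

  rate-distance-tradeoff : ∀ {p q r s n d k} → p * n ≤ k * q → k * (r * n) ≤ n * d * s →
    p * r * n ≤ d * (q * s)
  rate-distance-tradeoff {p} {q} {r} {s} {zero} {d} _ _ =
    subst (_≤ d * (q * s)) (sym (*-zeroʳ (p * r))) z≤n
  rate-distance-tradeoff {p} {q} {r} {s} {n@(suc _)} {d} {k} pn≤kq krn≤nds =
    *-cancelʳ-≤ (p * r * n) (d * (q * s)) n (begin
      p * r * n * n      ≡⟨ e₁ p r n ⟩
      r * n * (p * n)    ≤⟨ *-monoʳ-≤ (r * n) pn≤kq ⟩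
      r * n * (k * q)    ≡⟨ e₂ r n k q ⟩
      q * (k * (r * n))  ≤⟨ *-monoʳ-≤ q krn≤nds ⟩
      q * (n * d * s)    ≡⟨ e₃ q s n d ⟩
      d * (q * s) * n    ∎)
    where
    open ≤-Reasoning
    e₁ : ∀ p r n → p * r * n * n ≡ r * n * (p * n)
    e₁ = solve-∀
    e₂ : ∀ r n k q → r * n * (k * q) ≡ q * (k * (r * n))
    e₂ = solve-∀
    e₃ : ∀ q s n d → q * (n * d * s) ≡ d * (q * s) * n
    e₃ = solve-∀

  locality-bound : ∀ {m n d} p q r s {C : List (BitStr n)} {f : BitStr m → BitStr n} →
    Unique C → 2 ^ (p * n) ≤ length C ^ q →
    (∀ x y → x ∈ C → y ∈ C → x ≢ y → r * n ≤ hamming x y * s) →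
    Local d f → ImageIs f C → p * r * n ≤ d * (q * s)
  locality-bound {n = n} {d} p q r s unique 2^pn≤∣C∣ᵠ distance local image
    with R , ∣C∣≤2^∣R∣ , ∣R∣*rn≤nds ← local-code⇒small-junta {r = r} {s} unique image local distance =
    rate-distance-tradeoff {p} {q} {r} {s} {n} {d} {∣ R ∣}
      (rate≤junta-size {p} {q} {n} {k = ∣ R ∣} 2^pn≤∣C∣ᵠ ∣C∣≤2^∣R∣) ∣R∣*rn≤nds

-- Opened only now: ℚ's _≤_, _<_ and _*_ would clash with ℕ's inside Combinatorics.
open import Data.Nat as ℕ using (ℕ; suc; NonZero)
open import Data.Nat.Properties using (*-identityʳ)
open import Data.Integer using (+_; -[1+_])
import Data.Integer as ℤ
import Data.Integer.Properties as ℤ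
open import Data.Rational using (ℚ; mkℚ; 0ℚ; 1ℚ; ↥_; ↧ₙ_; toℚᵘ; _<_; _≤_; _*_; *<*)
open import Data.Rational.Properties using (toℚᵘ-fromℚᵘ; toℚᵘ-homo-*; toℚᵘ-mono-≤; toℚᵘ-cancel-≤)
open import Data.Rational.Unnormalised using (*≤*) renaming (_≃_ to _≃ᵘ_; _/_ to _/ᵘ_; _≤_ to _≤ᵘ_)
open import Data.Rational.Unnormalised.Properties using ()
  renaming ( ≃-refl to ≃ᵘ-refl; ≃-sym to ≃ᵘ-sym; ≃-trans to ≃ᵘ-trans; ≃-reflexive to ≃ᵘ-reflexive
           ; *-cong to *ᵘ-cong; /-cong to /ᵘ-cong; ≤-respˡ-≃ to ≤ᵘ-respˡ-≃; ≤-respʳ-≃ to ≤ᵘ-respʳ-≃)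
open import Data.List using (List; length)
open import Data.List.Membership.Propositional using (_∈_)
open import Data.List.Relation.Unary.Unique.Propositional using (Unique)
open import Function using (_⇔_; mk⇔; Equivalence)
open import Relation.Binary.PropositionalEquality using (_≢_; refl; sym; subst; subst₂)

open Combinatorics using (locality-bound)

-- ℚ normalises products, so fractions are compared through ℚᵘ, where the
-- numerator of α * β * n is literally a product of numerators.
infix 4 _≈_÷_
_≈_÷_ : ℚ → ℕ → (b : ℕ) → .{{NonZero b}} → Set
x ≈ a ÷ b = toℚᵘ x ≃ᵘ (+ a /ᵘ b)

0<⇒≈∣↥∣÷↧ₙ : ∀ {x} → 0ℚ < x → x ≈ ℤ.∣ ↥ x ∣ ÷ ↧ₙ x
0<⇒≈∣↥∣÷↧ₙ {mkℚ (+ _)    _ _} _ = ≃ᵘ-refl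
0<⇒≈∣↥∣÷↧ₙ {mkℚ -[1+ _ ] _ _} (*<* ())

ℕ→ℚ-≈÷ : ∀ k → ℕ→ℚ k ≈ k ÷ 1
ℕ→ℚ-≈÷ k = toℚᵘ-fromℚᵘ (+ k /ᵘ 1)

*-≈÷ : ∀ {x y a b c e} → x ≈ a ÷ suc b → y ≈ c ÷ suc e → x * y ≈ (a ℕ.* c) ÷ (suc b ℕ.* suc e)
*-≈÷ {x} {y} {a} {c = c} x≈ y≈ = ≃ᵘ-trans (toℚᵘ-homo-* x y)
  (≃ᵘ-trans (*ᵘ-cong x≈ y≈) (≃ᵘ-reflexive (/ᵘ-cong (sym (ℤ.pos-* a c)) refl)))

*ℕ→ℚ-≈÷ : ∀ {x a b} k → x ≈ a ÷ suc b → x * ℕ→ℚ k ≈ (a ℕ.* k) ÷ suc b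
*ℕ→ℚ-≈÷ {b = b} k x≈ =
  ≃ᵘ-trans (*-≈÷ x≈ (ℕ→ℚ-≈÷ k)) (≃ᵘ-reflexive (/ᵘ-cong refl (*-identityʳ (suc b))))

≈÷-≤⇔ : ∀ {x y a b c e} → x ≈ a ÷ suc b → y ≈ c ÷ suc e → x ≤ y ⇔ a ℕ.* suc e ℕ.≤ c ℕ.* suc b
≈÷-≤⇔ {x} {y} {a} {b} {c} {e} x≈ y≈ = mk⇔
  (λ x≤y → cross-multiply (≤ᵘ-respʳ-≃ y≈ (≤ᵘ-respˡ-≃ x≈ (toℚᵘ-mono-≤ x≤y))))
  (λ ae≤cb → toℚᵘ-cancel-≤ (≤ᵘ-respʳ-≃ (≃ᵘ-sym y≈) (≤ᵘ-respˡ-≃ (≃ᵘ-sym x≈) (divide ae≤cb))))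
  where
  cross-multiply : + a /ᵘ suc b ≤ᵘ + c /ᵘ suc e → a ℕ.* suc e ℕ.≤ c ℕ.* suc b
  cross-multiply (*≤* ae≤cb) = ℤ.drop‿+≤+ (subst₂ ℤ._≤_ (sym (ℤ.pos-* a _)) (sym (ℤ.pos-* c _)) ae≤cb)
  divide : a ℕ.* suc e ℕ.≤ c ℕ.* suc b → + a /ᵘ suc b ≤ᵘ + c /ᵘ suc e
  divide ae≤cb = *≤* (subst₂ ℤ._≤_ (ℤ.pos-* a _) (ℤ.pos-* c _) (ℤ.+≤+ ae≤cb))

≈÷-≤ℕ→ℚ⇔ : ∀ {x a b} k → x ≈ a ÷ suc b → x ≤ ℕ→ℚ k ⇔ a ℕ.≤ k ℕ.* suc b
≈÷-≤ℕ→ℚ⇔ {a = a} k x≈ = subst (λ a′ → _ ⇔ a′ ℕ.≤ _) (*-identityʳ a) (≈÷-≤⇔ x≈ (ℕ→ℚ-≈÷ k))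

mainTheorem9 : (α β : ℚ) → 0ℚ < α → α < 1ℚ → 0ℚ < β → β < 1ℚ →
    (n m d : ℕ) (C : List (BitStr n)) → Unique C →
    TwoPowLe α n (length C) →
    (∀ x y → x ∈ C → y ∈ C → x ≢ y → β * ℕ→ℚ n ≤ ℕ→ℚ (hamming x y)) →
    (f : BitStr m → BitStr n) → Local d f → ImageIs f C →
    α * β * ℕ→ℚ n ≤ ℕ→ℚ d
mainTheorem9 α β 0<α _ 0<β _ n m d C unique 2^αn≤∣C∣ distance f local image =
  Equivalence.from (≈÷-≤ℕ→ℚ⇔ d (*ℕ→ℚ-≈÷ n (*-≈÷ α≈ β≈)))
    (locality-bound ℤ.∣ ↥ α ∣ (↧ₙ α) ℤ.∣ ↥ β ∣ (↧ₙ β) unique 2^αn≤∣C∣ distanceℕ local image)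
  where
  α≈ : α ≈ ℤ.∣ ↥ α ∣ ÷ ↧ₙ α
  α≈ = 0<⇒≈∣↥∣÷↧ₙ 0<α
  β≈ : β ≈ ℤ.∣ ↥ β ∣ ÷ ↧ₙ β
  β≈ = 0<⇒≈∣↥∣÷↧ₙ 0<β
  distanceℕ : ∀ x y → x ∈ C → y ∈ C → x ≢ y → ℤ.∣ ↥ β ∣ ℕ.* n ℕ.≤ hamming x y ℕ.* ↧ₙ β
  distanceℕ x y x∈C y∈C x≢y =
    Equivalence.to (≈÷-≤ℕ→ℚ⇔ (hamming x y) (*ℕ→ℚ-≈÷ n β≈)) (distance x y x∈C y∈C x≢y)
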